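{- Let $\Gamma$ be a distance-regular graph with valency $k\geq 3$ and diameter $D\geq 4$. Let $i\in\{2,3,\ldots,D\}$. If $a_i\neq 0$ and $2c_i+c_{D-i}>k$, then $a_{i-1}\neq 0$.
   Context: A connected graph $\Gamma$ with diameter $D$ is distance-regular if there are integers $b_i,c_i$ ($0\le i\le D$) such that for any two vertices $x,y$ at distance $i$, exactly $c_i$ neighbours of $y$ are at distance $i-1$ from $x$ and exactly $b_i$ neighbours of $y$ are at distance $i+1$ from $x$, with $b_D=c_0=0$. The valency is $k=b_0$, and $a_i=k-b_i-c_i$ is the number of neighbours of $y$ at distance $i$ from $x$ when $d(x,y)=i$. -}

module Defs where

open import Data.Nat using (ℕ; zero; suc; _∸_; _≤_; _<_)
open import Data.Bool using (Bool; true; false; _∧_; _∨_; not; if_then_else_)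
open import Data.Fin using (Fin)
open import Data.Fin.Properties using (_≟_)
open import Data.List using (List; allFin; map)
open import Data.Bool.ListAction using (any)
open import Data.Nat.ListAction using (sum)
open import Data.Product using (Σ; _×_; ∃)
open import Relation.Nullary.Decidable using (⌊_⌋)
open import Relation.Binary.PropositionalEquality using (_≡_)

record Graph : Set where
  field
    n         : ℕ
    adj       : Fin n → Fin n → Bool
    adj-sym   : ∀ x y → adj x y ≡ adj y x
    adj-irrefl : ∀ x → adj x x ≡ false

module _ (G : Graph) where
  open Graph G

  Vertex : Set
  Vertex = Fin n

  reach : ℕ → Vertex → Vertex → Bool
  reach zero    x y = ⌊ x ≟ y ⌋
  reach (suc i) x y = reach i x y ∨ any (λ z → adj x z ∧ reach i z y) (allFin n)

  isDist : ℕ → Vertex → Vertex → Bool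
  isDist zero    x y = reach zero x y
  isDist (suc i) x y = reach (suc i) x y ∧ not (reach i x y)

  countV : (Vertex → Bool) → ℕ
  countV p = sum (map (λ z → if p z then 1 else 0) (allFin n))

  nbrsAt : ℕ → Vertex → Vertex → ℕ
  nbrsAt j x y = countV (λ z → adj y z ∧ isDist j x z)

  HasDiameter : ℕ → Set
  HasDiameter D = (∀ x y → reach D x y ≡ true)
                × Σ Vertex (λ x → Σ Vertex (λ y → isDist D x y ≡ true))

  record IsDistanceRegular (D : ℕ) (b c : ℕ → ℕ) : Set where
    field
      diameter : HasDiameter D
      c₀       : c 0 ≡ 0
      b_D      : b D ≡ 0
      c-reg    : ∀ i → 1 ≤ i → i ≤ D → ∀ x y → isDist i x y ≡ true → nbrsAt (i ∸ 1) x y ≡ c i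
      b-reg    : ∀ i → i ≤ D → ∀ x y → isDist i x y ≡ true → nbrsAt (suc i) x y ≡ b i

-- a_i = k - b_i - c_i, with k = b_0
aNum : (b c : ℕ → ℕ) → ℕ → ℕ
aNum b c i = b 0 ∸ b i ∸ c i

-- Choose w, y with d(w,y) = D and x on a geodesic between them with d(w,x) = D − i and
-- d(x,y) = i. As a_i ≠ 0, y has a neighbour z with d(x,z) = i. Among the k neighbours of x
-- consider S₁ = Γ(x) ∩ Γ_{i−1}(y), S₂ = Γ(x) ∩ Γ_{i−1}(z) and S₃ = Γ(x) ∩ Γ_{D−i−1}(w), of sizes
-- c_i, c_i and c_{D−i}. A vertex of S₃ in S₁ or S₂ would bring w and y closer than D, and a
-- vertex t of S₁ ∩ S₂ would make z a neighbour of y at distance i − 1 from t, impossible when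
-- a_{i−1} = 0. So a_{i−1} = 0 forces 2c_i + c_{D−i} ≤ k.
module Submission where

open import Defs
open import Data.Nat using (ℕ; zero; suc; _∸_; _≤_; _<_; _+_; _*_; z≤n; s≤s; _≤?_)
open import Data.Nat.Properties
  using (≤-antisym; ≰⇒>; n≮n; <⇒≢; <⇒≱; <⇒≤; n<1+n; m≤n⇒m≤1+n; m<n⇒m<1+n; +-comm; +-assoc; +-identityʳ;
         +-cancelʳ-≤; +-suc; ∸-+-assoc; m+n∸n≡m; m∸n+n≡m; m∸n≤m; ≤-pred; module ≤-Reasoning)
open import Data.Bool using (Bool; true; false; _∧_; _∨_; not; if_then_else_)
open import Data.Bool.Properties using (∧-conicalˡ; ∧-conicalʳ; ∨-zeroʳ; ¬-not; T-≡)
open import Data.Bool.ListAction using (any)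
open import Data.Nat.ListAction using (sum)
open import Data.List using (List; []; _∷_; allFin; map)
open import Data.List.Membership.Propositional using (_∈_; lose)
open import Data.List.Membership.Propositional.Properties using (∈-allFin)
open import Data.List.Relation.Unary.Any using (here; there; satisfied)
open import Data.List.Relation.Unary.Any.Properties using (any⁺; any⁻)
open import Data.Product using (∃-syntax; _×_; _,_; proj₂)
open import Data.Sum using (_⊎_; inj₁; inj₂)
import Data.Sum as Sum
open import Data.Empty using (⊥; ⊥-elim)
open import Function using (_∘_; Equivalence)
open import Relation.Nullary using (¬_; yes; no; contradiction)
open import Relation.Nullary.Decidable using (toWitness; fromWitness)
open import Relation.Binary.PropositionalEquality

open Equivalence using (to; from)

module BoolPredicates {A : Set} where

  infixl 6 _∪_
  infix 4 _⊆_

  _∪_ : (A → Bool) → (A → Bool) → A → Bool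
  (p ∪ q) z = p z ∨ q z

  _⊆_ : (A → Bool) → (A → Bool) → Set
  p ⊆ q = ∀ z → p z ≡ true → q z ≡ true

  Disjoint : (A → Bool) → (A → Bool) → Set
  Disjoint p q = ∀ z → p z ≡ true → q z ≡ true → ⊥

  count : (A → Bool) → List A → ℕ
  count p xs = sum (map (λ z → if p z then 1 else 0) xs)

  ⊆-∪ˡ : ∀ p q → p ⊆ p ∪ q
  ⊆-∪ˡ _ _ z pz rewrite pz = refl

  ⊆-∪ʳ : ∀ p q → q ⊆ p ∪ q
  ⊆-∪ʳ p _ z qz = trans (cong (p z ∨_) qz) (∨-zeroʳ (p z))

  ⊆-∪₃ : ∀ {s} p q r → (∀ z → s z ≡ true → p z ≡ true ⊎ q z ≡ true ⊎ r z ≡ true) →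
         s ⊆ p ∪ q ∪ r
  ⊆-∪₃ p q r cases z sz with cases z sz
  ... | inj₁ pz        = ⊆-∪ˡ (p ∪ q) r z (⊆-∪ˡ p q z pz)
  ... | inj₂ (inj₁ qz) = ⊆-∪ˡ (p ∪ q) r z (⊆-∪ʳ p q z qz)
  ... | inj₂ (inj₂ rz) = ⊆-∪ʳ (p ∪ q) r z rz

  ∪-⊆ : ∀ {p q r} → p ⊆ r → q ⊆ r → p ∪ q ⊆ r
  ∪-⊆ {p} p⊆r q⊆r z pqz with p z in pz
  ... | true  = p⊆r z pz
  ... | false = q⊆r z pqz

  Disjoint-∪ˡ : ∀ {p q r} → Disjoint p r → Disjoint q r → Disjoint (p ∪ q) r
  Disjoint-∪ˡ {p} pr qr z pqz rz with p z in pz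
  ... | true  = pr z pz rz
  ... | false = qr z pqz rz

  any-witness : ∀ {p} (xs : List A) → any p xs ≡ true → ∃[ z ] p z ≡ true
  any-witness {p} xs e with z , pz ← satisfied (any⁻ p xs (from T-≡ e)) = z , to T-≡ pz

  any-intro : ∀ {p xs} {z : A} → z ∈ xs → p z ≡ true → any p xs ≡ true
  any-intro {p} z∈xs pz = to T-≡ (any⁺ p (lose z∈xs (from T-≡ pz)))

  count-mono : ∀ {p q} → p ⊆ q → ∀ (xs : List A) → count p xs ≤ count q xs
  count-mono p⊆q [] = z≤n
  count-mono {p} {q} p⊆q (x ∷ xs) with p x in px | q x in qx
  ... | true  | true  = s≤s (count-mono p⊆q xs)
  ... | true  | false with () ← trans (sym (p⊆q x px)) qx
  ... | false | true  = m≤n⇒m≤1+n (count-mono p⊆q xs)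
  ... | false | false = count-mono p⊆q xs

  count-⊆-antisym : ∀ {p q} → p ⊆ q → q ⊆ p → ∀ xs → count p xs ≡ count q xs
  count-⊆-antisym p⊆q q⊆p xs = ≤-antisym (count-mono p⊆q xs) (count-mono q⊆p xs)

  count-∪ : ∀ {p q} → Disjoint p q → ∀ xs → count (p ∪ q) xs ≡ count p xs + count q xs
  count-∪ p∩q [] = refl
  count-∪ {p} {q} p∩q (x ∷ xs) with p x in px | q x in qx
  ... | true  | true  = ⊥-elim (p∩q x px qx)
  ... | true  | false = cong suc (count-∪ p∩q xs)
  ... | false | true  = trans (cong suc (count-∪ p∩q xs)) (sym (+-suc (count p xs) (count q xs)))
  ... | false | false = count-∪ p∩q xs

  count-∪₃ : ∀ {p q r} → Disjoint p q → Disjoint p r → Disjoint q r → ∀ xs →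
             count (p ∪ q ∪ r) xs ≡ count p xs + count q xs + count r xs
  count-∪₃ {p} {q} {r} p∩q p∩r q∩r xs = begin
    count (p ∪ q ∪ r) xs              ≡⟨ count-∪ (Disjoint-∪ˡ p∩r q∩r) xs ⟩
    count (p ∪ q) xs + count r xs     ≡⟨ cong (_+ count r xs) (count-∪ p∩q xs) ⟩
    count p xs + count q xs + count r xs ∎
    where open ≡-Reasoning

  count≡0 : ∀ {p} → (∀ z → p z ≢ true) → ∀ xs → count p xs ≡ 0
  count≡0 ¬p [] = refl
  count≡0 {p} ¬p (x ∷ xs) with p x in px
  ... | true  = ⊥-elim (¬p x px)
  ... | false = count≡0 ¬p xs

  count≢0 : ∀ {p xs} {z : A} → z ∈ xs → p z ≡ true → count p xs ≢ 0
  count≢0 {p} (here refl) pz rewrite pz = λ ()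
  count≢0 {p} {x ∷ _} (there z∈xs) pz with p x
  ... | true  = λ ()
  ... | false = count≢0 z∈xs pz

  count≢0⇒witness : ∀ {p} (xs : List A) → count p xs ≢ 0 → ∃[ z ] p z ≡ true
  count≢0⇒witness [] c≢0 = ⊥-elim (c≢0 refl)
  count≢0⇒witness {p} (x ∷ xs) c≢0 with p x in px
  ... | true  = x , px
  ... | false = count≢0⇒witness xs c≢0

open BoolPredicates

sum≡⇒middle≡ : ∀ {k a} b c → k ≡ c + a + b → a ≡ k ∸ b ∸ c
sum≡⇒middle≡ {a = a} b c refl = sym (begin
  c + a + b ∸ b ∸ c     ≡⟨ ∸-+-assoc (c + a + b) b c ⟩
  c + a + b ∸ (b + c)   ≡⟨ cong (_∸ (b + c)) reorder ⟩
  a + (b + c) ∸ (b + c) ≡⟨ m+n∸n≡m a (b + c) ⟩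
  a                     ∎)
  where
  open ≡-Reasoning
  reorder : c + a + b ≡ a + (b + c)
  reorder = begin
    c + a + b   ≡⟨ cong (_+ b) (+-comm c a) ⟩
    a + c + b   ≡⟨ +-assoc a c b ⟩
    a + (c + b) ≡⟨ cong (a +_) (+-comm c b) ⟩
    a + (b + c) ∎

module Distance (G : Graph) where
  open Graph G

  -- Records rather than bare `≡ true` equations, so that unification recovers the indices.
  record Reach (j : ℕ) (x y : Vertex G) : Set where
    constructor mkReach
    field reach≡true : reach G j x y ≡ true

  record Dist (j : ℕ) (x y : Vertex G) : Set where
    constructor mkDist
    field isDist≡true : isDist G j x y ≡ true

  open Reach public
  open Dist public

  NbrsAt : ℕ → Vertex G → Vertex G → Vertex G → Bool
  NbrsAt j x y z = adj y z ∧ isDist G j x z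

  reach-refl : ∀ x → Reach 0 x x
  reach-refl x = mkReach (to T-≡ (fromWitness refl))

  reach-0⇒≡ : ∀ {x y} → Reach 0 x y → x ≡ y
  reach-0⇒≡ (mkReach r) = toWitness (from T-≡ r)

  dist-refl : ∀ x → Dist 0 x x
  dist-refl x = mkDist (reach≡true (reach-refl x))

  reach-suc : ∀ {j x y} → Reach j x y → Reach (suc j) x y
  reach-suc (mkReach r) = mkReach (cong₂ _∨_ r refl)

  reach-step : ∀ {j x z y} → adj x z ≡ true → Reach j z y → Reach (suc j) x y
  reach-step {j} {x} {z} {y} xz (mkReach zy) = mkReach
    (trans (cong (reach G j x y ∨_) (any-intro (∈-allFin z) (cong₂ _∧_ xz zy))) (∨-zeroʳ _))

  reach-split : ∀ {j x y} → Reach (suc j) x y → Reach j x y ⊎ ∃[ z ] adj x z ≡ true × Reach j z y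
  reach-split {j} {x} {y} (mkReach r) with reach G j x y in xy
  ... | true  = inj₁ (mkReach xy)
  ... | false with z , xzy ← any-witness (allFin n) r =
    inj₂ (z , ∧-conicalˡ _ _ xzy , mkReach (∧-conicalʳ _ _ xzy))

  reach-snoc : ∀ {j x y z} → Reach j x y → adj y z ≡ true → Reach (suc j) x z
  reach-snoc {zero} r yz rewrite reach-0⇒≡ r = reach-step yz (reach-refl _)
  reach-snoc {suc j} r yz with reach-split r
  ... | inj₁ r′            = reach-suc (reach-snoc r′ yz)
  ... | inj₂ (u , xu , uy) = reach-step xu (reach-snoc uy yz)

  reach-mono : ∀ {j m x y} → j ≤ m → Reach j x y → Reach m x y
  reach-mono {zero} {zero} _ r = r
  reach-mono {zero} {suc m} _ r = reach-suc (reach-mono {m = m} z≤n r)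
  reach-mono {suc j} {suc m} (s≤s j≤m) r with reach-split r
  ... | inj₁ r′            = reach-suc (reach-mono j≤m r′)
  ... | inj₂ (u , xu , uy) = reach-step xu (reach-mono j≤m uy)

  reach-trans : ∀ {i j x y z} → Reach i x y → Reach j y z → Reach (i + j) x z
  reach-trans {zero} r s rewrite reach-0⇒≡ r = s
  reach-trans {suc i} r s with reach-split r
  ... | inj₁ r′            = reach-suc (reach-trans r′ s)
  ... | inj₂ (u , xu , uy) = reach-step xu (reach-trans uy s)

  reach-sym : ∀ {j x y} → Reach j x y → Reach j y x
  reach-sym {zero} r rewrite reach-0⇒≡ r = reach-refl _
  reach-sym {suc j} {x} r with reach-split r
  ... | inj₁ r′            = reach-suc (reach-sym r′)
  ... | inj₂ (u , xu , uy) = reach-snoc (reach-sym uy) (trans (adj-sym u x) xu)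

  adj⇒≢ : ∀ {x y} → adj x y ≡ true → x ≢ y
  adj⇒≢ {x} xy refl with () ← trans (sym xy) (adj-irrefl x)

  dist⇒reach : ∀ {j x y} → Dist j x y → Reach j x y
  dist⇒reach {zero}  (mkDist d) = mkReach d
  dist⇒reach {suc j} (mkDist d) = mkReach (∧-conicalˡ _ _ d)

  dist⇒¬reach-pred : ∀ {j x y} → Dist (suc j) x y → ¬ Reach j x y
  dist⇒¬reach-pred (mkDist d) (mkReach r) with () ← trans (cong not (sym r)) (∧-conicalʳ _ _ d)

  dist-minimal : ∀ {j m x y} → Dist j x y → Reach m x y → j ≤ m
  dist-minimal {zero}      _ _ = z≤n
  dist-minimal {suc j} {m} d r with m ≤? j
  ... | yes m≤j = contradiction (reach-mono m≤j r) (dist⇒¬reach-pred d)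
  ... | no  m≰j = ≰⇒> m≰j

  dist-intro : ∀ {j x y} → Reach j x y → (∀ {m} → Reach m x y → j ≤ m) → Dist j x y
  dist-intro {zero}  (mkReach r) _       = mkDist r
  dist-intro {suc j} (mkReach r) minimal =
    mkDist (cong₂ _∧_ r (cong not (¬-not λ r′ → n≮n j (minimal (mkReach r′)))))

  dist-sym : ∀ {j x y} → Dist j x y → Dist j y x
  dist-sym d = dist-intro (reach-sym (dist⇒reach d)) (dist-minimal d ∘ reach-sym)

  dist-unique : ∀ {j k x y} → Dist j x y → Dist k x y → j ≡ k
  dist-unique d e = ≤-antisym (dist-minimal d (dist⇒reach e)) (dist-minimal e (dist⇒reach d))

  dist-adj : ∀ {x y} → adj x y ≡ true → Dist 1 x y
  dist-adj xy = dist-intro (reach-step xy (reach-refl _)) positive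
    where
    positive : ∀ {m} → Reach m _ _ → 1 ≤ m
    positive {zero}  r = contradiction (reach-0⇒≡ r) (adj⇒≢ xy)
    positive {suc m} _ = s≤s z≤n

  geodesic-step : ∀ {k w y} → Dist (suc k) w y → ∃[ u ] adj w u ≡ true × Dist k u y
  geodesic-step d with reach-split (dist⇒reach d)
  ... | inj₁ r             = contradiction r (dist⇒¬reach-pred d)
  ... | inj₂ (u , wu , uy) = u , wu , dist-intro uy λ uy′ → ≤-pred (dist-minimal d (reach-step wu uy′))

  geodesic : ∀ m {i w y} → Dist (m + i) w y → ∃[ x ] Dist m w x × Dist i x y
  geodesic zero {w = w} d = w , dist-refl w , d
  geodesic (suc m) {i} d
    with u , wu , uy ← geodesic-step d
    with x , ux , xy ← geodesic m uy
    = x , dist-intro (reach-step wu (dist⇒reach ux)) minimal , xy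
    where
    minimal : ∀ {m′} → Reach m′ _ x → suc m ≤ m′
    minimal wx = +-cancelʳ-≤ i _ _ (dist-minimal d (reach-trans wx (dist⇒reach xy)))

  dist-0⇒≡ : ∀ {x y} → Dist 0 x y → x ≡ y
  dist-0⇒≡ = reach-0⇒≡ ∘ dist⇒reach

  closer-neighbour⇒¬reach : ∀ {m i w x t y} → Dist (m + i) w y → Dist m w x → adj x t ≡ true →
                            Dist (m ∸ 1) w t → ¬ Reach i t y
  closer-neighbour⇒¬reach {zero}  _  wx xt wt _  = adj⇒≢ xt (trans (sym (dist-0⇒≡ wx)) (dist-0⇒≡ wt))
  closer-neighbour⇒¬reach {suc m} wy _  _  wt ty = n≮n _ (dist-minimal wy (reach-trans (dist⇒reach wt) ty))

  neighbour-distance : ∀ {j x y z} → Dist (suc j) x y → adj y z ≡ true →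
                       Dist j x z ⊎ Dist (suc j) x z ⊎ Dist (suc (suc j)) x z
  neighbour-distance {j} {x} {y} {z} d yz with reach G (suc j) x z in xz′ | reach G j x z in xz
  ... | _     | true  = inj₁ (dist-intro (mkReach xz) λ xz″ →
                          ≤-pred (dist-minimal d (reach-snoc xz″ (trans (adj-sym z y) yz))))
  ... | true  | false = inj₂ (inj₁ (mkDist (cong₂ _∧_ xz′ (cong not xz))))
  ... | false | false =
    inj₂ (inj₂ (mkDist (cong₂ _∧_ (reach≡true (reach-snoc (dist⇒reach d) yz)) (cong not xz′))))

  NbrsAt⊆adj : ∀ j u {x} → NbrsAt j u x ⊆ adj x
  NbrsAt⊆adj _ _ _ = ∧-conicalˡ _ _

  NbrsAt-disjoint : ∀ {j j′ u u′ x} → (∀ {t} → adj x t ≡ true → Dist j u t → Dist j′ u′ t → ⊥) →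
                    Disjoint (NbrsAt j u x) (NbrsAt j′ u′ x)
  NbrsAt-disjoint separated t p q =
    separated (∧-conicalˡ _ _ p) (mkDist (∧-conicalʳ _ _ p)) (mkDist (∧-conicalʳ _ _ q))

  neighbour-partition : ∀ {j x y} → Dist (suc j) x y →
    countV G (adj y) ≡ nbrsAt G j x y + nbrsAt G (suc j) x y + nbrsAt G (suc (suc j)) x y
  neighbour-partition {j} {x} {y} d = begin
    count (adj y) (allFin n)                              ≡⟨ count-⊆-antisym cover covered (allFin n) ⟩
    count (P j ∪ P (suc j) ∪ P (suc (suc j))) (allFin n)  ≡⟨ count-∪₃ (apart (<⇒≢ (n<1+n j)))
                                                                       (apart (<⇒≢ (m<n⇒m<1+n (n<1+n j))))
                                                                       (apart (<⇒≢ (n<1+n (suc j)))) (allFin n) ⟩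
    nbrsAt G j x y + nbrsAt G (suc j) x y + nbrsAt G (suc (suc j)) x y ∎
    where
    open ≡-Reasoning
    P : ℕ → Vertex G → Bool
    P e = NbrsAt e x y
    apart : ∀ {e e′} → e ≢ e′ → Disjoint (P e) (P e′)
    apart e≢e′ = NbrsAt-disjoint λ _ d d′ → e≢e′ (dist-unique d d′)
    atDistance : ∀ {e z} → adj y z ≡ true → Dist e x z → P e z ≡ true
    atDistance yz (mkDist xz) = cong₂ _∧_ yz xz
    covered : P j ∪ P (suc j) ∪ P (suc (suc j)) ⊆ adj y
    covered = ∪-⊆ (∪-⊆ (NbrsAt⊆adj j x) (NbrsAt⊆adj (suc j) x)) (NbrsAt⊆adj (suc (suc j)) x)
    cover : adj y ⊆ P j ∪ P (suc j) ∪ P (suc (suc j))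
    cover = ⊆-∪₃ (P j) (P (suc j)) (P (suc (suc j))) λ z yz →
      Sum.map (atDistance yz) (Sum.map (atDistance yz) (atDistance yz)) (neighbour-distance d yz)

module DistanceRegular {G : Graph} {D : ℕ} {b c : ℕ → ℕ} (dr : IsDistanceRegular G D b c) where
  open Graph G
  open Distance G
  open IsDistanceRegular dr

  degree : ∀ y → countV G (adj y) ≡ b 0
  degree y = trans (count-⊆-antisym adj⊆NbrsAt₁ (NbrsAt⊆adj 1 y) (allFin n))
                   (b-reg 0 z≤n y y (isDist≡true (dist-refl y)))
    where
    adj⊆NbrsAt₁ : adj y ⊆ NbrsAt 1 y y
    adj⊆NbrsAt₁ z yz = cong₂ _∧_ yz (isDist≡true (dist-adj yz))

  neighbour-count : ∀ {j x y} → suc j ≤ D → Dist (suc j) x y →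
                    b 0 ≡ c (suc j) + nbrsAt G (suc j) x y + b (suc j)
  neighbour-count {j} {x} {y} j<D d = begin
    b 0
      ≡⟨ degree y ⟨
    countV G (adj y)
      ≡⟨ neighbour-partition d ⟩
    nbrsAt G j x y + nbrsAt G (suc j) x y + nbrsAt G (suc (suc j)) x y
      ≡⟨ cong₂ (λ p q → p + nbrsAt G (suc j) x y + q) (c-reg (suc j) (s≤s z≤n) j<D x y (isDist≡true d))
                                                     (b-reg (suc j) j<D x y (isDist≡true d)) ⟩
    c (suc j) + nbrsAt G (suc j) x y + b (suc j)
      ∎
    where open ≡-Reasoning

  nbrsAt≡a : ∀ {j x y} → suc j ≤ D → Dist (suc j) x y → nbrsAt G (suc j) x y ≡ aNum b c (suc j)
  nbrsAt≡a {j} j<D d = sum≡⇒middle≡ (b (suc j)) (c (suc j)) (neighbour-count j<D d)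

  nbrsAt≡c : ∀ {m w x} → m ≤ D → Dist m w x → nbrsAt G (m ∸ 1) w x ≡ c m
  -- For m = 0 the index m ∸ 1 truncates to 0; both sides vanish since x = w and c 0 = 0.
  nbrsAt≡c {zero} _ wx = trans (count≡0 no-neighbour (allFin n)) (sym c₀)
    where
    no-neighbour : ∀ t → NbrsAt 0 _ _ t ≢ true
    no-neighbour t p =
      adj⇒≢ (∧-conicalˡ _ _ p) (trans (sym (dist-0⇒≡ wx)) (dist-0⇒≡ (mkDist (∧-conicalʳ _ _ p))))
  nbrsAt≡c {suc m} m<D (mkDist d) = c-reg (suc m) (s≤s z≤n) m<D _ _ d

  a≢0⇒neighbour : ∀ {j x y} → suc j ≤ D → Dist (suc j) x y → aNum b c (suc j) ≢ 0 →
                  ∃[ z ] adj y z ≡ true × Dist (suc j) x z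
  a≢0⇒neighbour {j} {x} {y} j<D d a≢0
    with z , p ← count≢0⇒witness {p = NbrsAt (suc j) x y} (allFin n)
                                 (a≢0 ∘ trans (sym (nbrsAt≡a j<D d)))
    = z , ∧-conicalˡ (adj y z) _ p , mkDist (∧-conicalʳ (adj y z) _ p)

  a≡0⇒no-common-dist : ∀ {j y z t} → suc j ≤ D → aNum b c (suc j) ≡ 0 → adj y z ≡ true →
                       Dist (suc j) y t → Dist (suc j) z t → ⊥
  a≡0⇒no-common-dist {j} {y} {z} {t} j<D a≡0 yz yt zt =
    count≢0 {p = NbrsAt (suc j) t y} (∈-allFin z) (cong₂ _∧_ yz (isDist≡true (dist-sym zt)))
      (trans (nbrsAt≡a j<D (dist-sym yt)) a≡0)

  diametral-geodesic : ∀ {i} → i ≤ D →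
    ∃[ w ] ∃[ x ] ∃[ y ] Dist (D ∸ i + i) w y × Dist (D ∸ i) w x × Dist i x y
  diametral-geodesic {i} i≤D
    with w , y , wy ← proj₂ diameter
    with wy′ ← subst (λ e → Dist e w y) (sym (m∸n+n≡m i≤D)) (mkDist wy)
    with x , wx , xy ← geodesic (D ∸ i) wy′
    = w , x , y , wy′ , wx , xy

  disjoint-neighbour-sets : ∀ {x} j₁ u₁ j₂ u₂ j₃ u₃ →
    Disjoint (NbrsAt j₁ u₁ x) (NbrsAt j₂ u₂ x) → Disjoint (NbrsAt j₁ u₁ x) (NbrsAt j₃ u₃ x) →
    Disjoint (NbrsAt j₂ u₂ x) (NbrsAt j₃ u₃ x) →
    nbrsAt G j₁ u₁ x + nbrsAt G j₂ u₂ x + nbrsAt G j₃ u₃ x ≤ b 0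
  disjoint-neighbour-sets {x} j₁ u₁ j₂ u₂ j₃ u₃ d₁₂ d₁₃ d₂₃ = begin
    nbrsAt G j₁ u₁ x + nbrsAt G j₂ u₂ x + nbrsAt G j₃ u₃ x ≡⟨ count-∪₃ d₁₂ d₁₃ d₂₃ (allFin n) ⟨
    count (NbrsAt j₁ u₁ x ∪ NbrsAt j₂ u₂ x ∪ NbrsAt j₃ u₃ x) (allFin n)
      ≤⟨ count-mono (∪-⊆ (∪-⊆ (NbrsAt⊆adj j₁ u₁) (NbrsAt⊆adj j₂ u₂)) (NbrsAt⊆adj j₃ u₃)) (allFin n) ⟩
    countV G (adj x)                                         ≡⟨ degree x ⟩
    b 0                                                      ∎
    where open ≤-Reasoning

lemma9 : (G : Graph) (D : ℕ) (b c : ℕ → ℕ) → IsDistanceRegular G D b c →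
         3 ≤ b 0 → 4 ≤ D →
         (i : ℕ) → 2 ≤ i → i ≤ D →
         aNum b c i ≢ 0 → b 0 < 2 * c i + c (D ∸ i) →
         aNum b c (i ∸ 1) ≢ 0
lemma9 G D b c dr _ _ i@(suc (suc j)) (s≤s (s≤s _)) i≤D aᵢ≢0 k<2cᵢ+cₘ aᵢ₋₁≡0
  with w , x , y , wy , wx , xy ← DistanceRegular.diametral-geodesic dr i≤D
  with z , yz , xz ← DistanceRegular.a≢0⇒neighbour dr i≤D xy aᵢ≢0
  = <⇒≱ k<2cᵢ+cₘ (begin
      2 * c i + c m    ≡⟨ cong (λ s → c i + s + c m) (+-identityʳ (c i)) ⟩
      c i + c i + c m  ≡⟨ cong₂ _+_ (cong₂ _+_ (nbrsAt≡c i≤D (dist-sym xy)) (nbrsAt≡c i≤D (dist-sym xz)))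
                                    (nbrsAt≡c (m∸n≤m D i) wx) ⟨
      nbrsAt G (suc j) y x + nbrsAt G (suc j) z x + nbrsAt G (m ∸ 1) w x
        ≤⟨ disjoint-neighbour-sets (suc j) y (suc j) z (m ∸ 1) w S₁∩S₂ S₁∩S₃ S₂∩S₃ ⟩
      b 0              ∎)
  where
  open Graph G
  open Distance G
  open DistanceRegular dr
  open ≤-Reasoning
  m : ℕ
  m = D ∸ i
  S₁∩S₂ : Disjoint (NbrsAt (suc j) y x) (NbrsAt (suc j) z x)
  S₁∩S₂ = NbrsAt-disjoint λ _ yt zt → a≡0⇒no-common-dist (<⇒≤ i≤D) aᵢ₋₁≡0 yz yt zt
  S₁∩S₃ : Disjoint (NbrsAt (suc j) y x) (NbrsAt (m ∸ 1) w x)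
  S₁∩S₃ = NbrsAt-disjoint λ xt yt wt →
    closer-neighbour⇒¬reach wy wx xt wt (reach-suc (dist⇒reach (dist-sym yt)))
  S₂∩S₃ : Disjoint (NbrsAt (suc j) z x) (NbrsAt (m ∸ 1) w x)
  S₂∩S₃ = NbrsAt-disjoint λ xt zt wt →
    closer-neighbour⇒¬reach wy wx xt wt (reach-snoc (dist⇒reach (dist-sym zt)) (trans (adj-sym z y) yz))
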